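{- 1. For every model $\mathfrak M$: $\mathfrak M\in\mathcal D_{P- }$ iff for every $p\in P0$ the sequent $(\{p\},((\perp\to\perp)\to\perp)\to p)$ is valid in $\mathfrak M$. 2. For every symmetric model $\mathfrak M$: $\mathfrak M$ is an interpretation iff for every $p\in P0$ the sequent $(\{p\},((p\to\perp)\to\perp)\to p)$ is valid in $\mathfrak M$. 3. For every transitive model $\mathfrak M$: $\mathfrak M$ is an interpretation iff for every $p\in P0$ the sequent $(\{p\},(\perp\to\perp)\to p)$ is valid in $\mathfrak M$.
   Context: Formulas are generated by $\varphi::=p\mid\perp\mid(\varphi\land\varphi)\mid(\varphi\to\varphi)$ with $p$ from a countable set $P0$. A model is $\mathfrak M=(W,R,V)$ with $W\ne\emptyset$, $R\subseteq W\times W$, $V:P0\to\wp(W)$. Satisfaction: $\mathfrak M,s\nvDash\perp$; $\mathfrak M,s\vDash p$ iff $s\in V(p)$; $\land$ pointwise; $\mathfrak M,s\vDash\varphi\to\psi$ iff for every $t$ with $sRt$, $\mathfrak M,t\vDash\varphi$ implies $\mathfrak M,t\vDash\psi$. A sequent $(\Gamma,\varphi)$ is valid in $\mathfrak M$ if for every $s\in W$, $\mathfrak M,s$ satisfying all of $\Gamma$ implies $\mathfrak M,s\vDash\varphi$. For $X\subseteq W$: $-X=W\setminus X$, $R[X]=\{t:\exists s\in X,\ sRt\}$, $R^\Box(X)=\{s:\forall t\,(sRt\Rightarrow t\in X)\}$. A proposition of $(W,R)$ is $X\subseteq W$ with $R[X]\cap R^\Box(R[X])\subseteq X$; an interpretation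 is a model with every $V(p)$ a proposition. $\mathcal D_{P- }$ is the class of models $(W,R,V)$ with $V(p)\subseteq R^\Box(-R^\Box(\emptyset)\cup V(p))$ for all $p\in P0$. -}

module Defs where

open import Level using (0ℓ) renaming (suc to lsuc)
open import Data.Nat using (ℕ)
open import Data.Empty using (⊥)
open import Data.Product using (Σ; ∃; _×_; _,_)
open import Data.Sum using (_⊎_)
open import Relation.Nullary using (¬_)

P0 : Set
P0 = ℕ

infixr 6 _∧_
infixr 5 _⇒_
data Form : Set where
  var : P0 → Form
  ⊥f  : Form
  _∧_ : Form → Form → Form
  _⇒_ : Form → Form → Form

Subset : Set → Set₁
Subset W = W → Set

record Model : Set₁ where
  field
    W   : Set
    w₀  : W                -- W ≠ ∅
    R   : W → W → Set
    V   : P0 → Subset W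

module _ {W : Set} where
  _⊆_ : Subset W → Subset W → Set
  X ⊆ Y = ∀ s → X s → Y s

  ∅ : Subset W
  ∅ _ = ⊥

  -_ : Subset W → Subset W
  (- X) s = ¬ X s

  _∪_ : Subset W → Subset W → Subset W
  (X ∪ Y) s = X s ⊎ Y s

  _∩_ : Subset W → Subset W → Subset W
  (X ∩ Y) s = X s × Y s

  image : (W → W → Set) → Subset W → Subset W
  image R X t = Σ W λ s → X s × R s t

  box : (W → W → Set) → Subset W → Subset W
  box R X s = ∀ t → R s t → X t

open Model

_,_⊨_ : (M : Model) → W M → Form → Set
M , s ⊨ var p = V M p s
M , s ⊨ ⊥f = ⊥
M , s ⊨ (φ ∧ ψ) = (M , s ⊨ φ) × (M , s ⊨ ψ)
M , s ⊨ (φ ⇒ ψ) = ∀ t → R M s t → M , t ⊨ φ → M , t ⊨ ψ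

data Member : Form → Form → Set where
  here : ∀ {φ} → Member φ φ

ValidSeq : Model → (Form → Set) → Form → Set
ValidSeq M Γ φ = ∀ s → (∀ ψ → Γ ψ → M , s ⊨ ψ) → M , s ⊨ φ

Single : Form → (Form → Set)
Single ψ χ = Member ψ χ

IsProposition : {W : Set} → (W → W → Set) → Subset W → Set
IsProposition R X = (image R X ∩ box R (image R X)) ⊆ X

IsInterpretation : Model → Set
IsInterpretation M = ∀ p → IsProposition (R M) (V M p)

InDP- : Model → Set
InDP- M = ∀ p → V M p ⊆ box (R M) ((- box (R M) ∅) ∪ V M p)

Symmetric : Model → Set
Symmetric M = ∀ s t → R M s t → R M t s

Transitive : Model → Set
Transitive M = ∀ s t u → R M s t → R M t u → R M s u

_⟺_ : Set → Set → Set
A ⟺ B = (A → B) × (B → A)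

-- Classical excluded middle (the paper's metatheory is classical)
ExcludedMiddle : Set₁
ExcludedMiddle = (A : Set) → A ⊎ (¬ A)

{-# OPTIONS --safe #-}
-- Each sequent ({p}, φ → p) says that V(p) is preserved along every R-step
-- into a world satisfying φ, and each of the three frame conditions is a
-- preservation property of the same shape, so everything reduces to computing
-- truth sets: ((⊥ → ⊥) → ⊥) holds exactly at dead ends, ((p → ⊥) → ⊥) holds
-- exactly on R^□(R[V(p)]) when R is symmetric, and (⊥ → ⊥) holds everywhere,
-- while under transitivity every R-successor of V(p) already lies in R^□(R[V(p)]).
module Submission where

open import Defs
open import Data.Product using (_×_; _,_; proj₁; proj₂)
open import Data.Sum using (inj₁; inj₂)
open import Data.Empty using (⊥-elim)

open Model

⟺-trans : {A B C : Set} → A ⟺ B → B ⟺ C → A ⟺ C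
⟺-trans (ab , ba) (bc , cb) = (λ a → bc (ab a)) , (λ c → ba (cb c))

⟺-sym : {A B : Set} → A ⟺ B → B ⟺ A
⟺-sym (ab , ba) = ba , ab

⟺-∀ : {I : Set} {A B : I → Set} → (∀ i → A i ⟺ B i) → (∀ i → A i) ⟺ (∀ i → B i)
⟺-∀ equiv = (λ a i → proj₁ (equiv i) (a i)) , (λ b i → proj₂ (equiv i) (b i))

module _ {W : Set} {R : W → W → Set} where

  Persistent : Subset W → Subset W → Set
  Persistent G X = ∀ s t → X s → R s t → G t → X t

  Persistent-antitone : {G G′ X : Subset W} → G′ ⊆ G → Persistent G X → Persistent G′ X
  Persistent-antitone G′⊆G pers s t xs st g′t = pers s t xs st (G′⊆G t g′t)

  Persistent-cong : {G G′ X : Subset W} → G ⊆ G′ → G′ ⊆ G → Persistent G X ⟺ Persistent G′ X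
  Persistent-cong G⊆G′ G′⊆G = Persistent-antitone G′⊆G , Persistent-antitone G⊆G′

  IsProposition⟺Persistent : {X : Subset W} → IsProposition R X ⟺ Persistent (box R (image R X)) X
  IsProposition⟺Persistent =
    (λ prop s t xs st bt → prop t ((s , xs , st) , bt)) ,
    (λ pers t ((s , xs , st) , bt) → pers s t xs st bt)

  ⊆box-∪⟺Persistent : ExcludedMiddle → {G X : Subset W} → (X ⊆ box R ((- G) ∪ X)) ⟺ Persistent G X
  ⊆box-∪⟺Persistent em {G} {X} = fw , bw
    where
    fw : X ⊆ box R ((- G) ∪ X) → Persistent G X
    fw sub s t xs st gt with sub s xs t st
    ... | inj₁ ¬gt = ⊥-elim (¬gt gt)
    ... | inj₂ xt = xt
    bw : Persistent G X → X ⊆ box R ((- G) ∪ X)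
    bw pers s xs t st with em (G t)
    ... | inj₁ gt = inj₂ (pers s t xs st gt)
    ... | inj₂ ¬gt = inj₁ ¬gt

truthSet : (M : Model) → Form → Subset (W M)
truthSet M φ s = M , s ⊨ φ

ValidSeq⟺Persistent : (M : Model) (p : P0) (φ : Form) →
  ValidSeq M (Single (var p)) (φ ⇒ var p) ⟺ Persistent {R = R M} (truthSet M φ) (V M p)
ValidSeq⟺Persistent M p φ =
  (λ valid s t ps st φt → valid s (λ { _ here → ps }) t st φt) ,
  (λ pers s prems t st φt → pers s t (prems (var p) here) st φt)

⊨⊤ : (M : Model) (s : W M) → M , s ⊨ (⊥f ⇒ ⊥f)
⊨⊤ M s t st ()

⊨¬⊤⊆deadEnd : (M : Model) → truthSet M ((⊥f ⇒ ⊥f) ⇒ ⊥f) ⊆ box (R M) ∅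
⊨¬⊤⊆deadEnd M s ¬⊤ t st = ¬⊤ t st (⊨⊤ M t)

deadEnd⊆⊨¬⊤ : (M : Model) → box (R M) ∅ ⊆ truthSet M ((⊥f ⇒ ⊥f) ⇒ ⊥f)
deadEnd⊆⊨¬⊤ M s dead t st _ = dead t st

module _ (M : Model) (symmetric : Symmetric M) (φ : Form) where

  box-image⊆⊨¬¬ : box (R M) (image (R M) (truthSet M φ)) ⊆ truthSet M ((φ ⇒ ⊥f) ⇒ ⊥f)
  box-image⊆⊨¬¬ s bi t st ¬φt with bi t st
  ... | u , φu , ut = ¬φt u (symmetric u t ut) φu

  ⊨¬¬⊆box-image : ExcludedMiddle → truthSet M ((φ ⇒ ⊥f) ⇒ ⊥f) ⊆ box (R M) (image (R M) (truthSet M φ))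
  ⊨¬¬⊆box-image em s ¬¬φ t st with em (image (R M) (truthSet M φ) t)
  ... | inj₁ reached = reached
  ... | inj₂ unreached = ⊥-elim (¬¬φ t st λ u tu φu → unreached (u , φu , symmetric t u tu))

reachable⊆box-image : (M : Model) → Transitive M → {X : Subset (W M)} {s t : W M} →
  X s → R M s t → box (R M) (image (R M) X) t
reachable⊆box-image M transitive {s = s} {t} xs st u tu = s , xs , transitive s t u st tu

InDP-⟺validDeadEnd : ExcludedMiddle → (M : Model) →
  InDP- M ⟺ (∀ p → ValidSeq M (Single (var p)) (((⊥f ⇒ ⊥f) ⇒ ⊥f) ⇒ var p))
InDP-⟺validDeadEnd em M = ⟺-∀ λ p →
  ⟺-trans (⊆box-∪⟺Persistent em)
  (⟺-trans (Persistent-cong (deadEnd⊆⊨¬⊤ M) (⊨¬⊤⊆deadEnd M))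
           (⟺-sym (ValidSeq⟺Persistent M p ((⊥f ⇒ ⊥f) ⇒ ⊥f))))

symmetric⇒IsInterpretation⟺validDoubleNegation : ExcludedMiddle → (M : Model) → Symmetric M →
  IsInterpretation M ⟺ (∀ p → ValidSeq M (Single (var p)) ((((var p) ⇒ ⊥f) ⇒ ⊥f) ⇒ var p))
symmetric⇒IsInterpretation⟺validDoubleNegation em M symmetric = ⟺-∀ λ p →
  ⟺-trans IsProposition⟺Persistent
  (⟺-trans (Persistent-cong (box-image⊆⊨¬¬ M symmetric (var p)) (⊨¬¬⊆box-image M symmetric (var p) em))
           (⟺-sym (ValidSeq⟺Persistent M p ((var p ⇒ ⊥f) ⇒ ⊥f))))

transitive⇒IsInterpretation⟺validTop : (M : Model) → Transitive M →
  IsInterpretation M ⟺ (∀ p → ValidSeq M (Single (var p)) ((⊥f ⇒ ⊥f) ⇒ var p))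
transitive⇒IsInterpretation⟺validTop M transitive = ⟺-∀ λ p →
  ⟺-trans IsProposition⟺Persistent
  (⟺-trans (unguard , Persistent-antitone (λ s _ → ⊨⊤ M s))
           (⟺-sym (ValidSeq⟺Persistent M p (⊥f ⇒ ⊥f))))
  where
  unguard : {X : Subset (W M)} → Persistent {R = R M} (box (R M) (image (R M) X)) X → Persistent (truthSet M (⊥f ⇒ ⊥f)) X
  unguard pers s t xs st _ = pers s t xs st (reachable⊆box-image M transitive xs st)

lemma9 : ExcludedMiddle →
         ((M : Model) → InDP- M ⟺ (∀ p → ValidSeq M (Single (var p)) (((⊥f ⇒ ⊥f) ⇒ ⊥f) ⇒ var p)))
         × ((M : Model) → Symmetric M → IsInterpretation M ⟺ (∀ p → ValidSeq M (Single (var p)) ((((var p) ⇒ ⊥f) ⇒ ⊥f) ⇒ var p)))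
         × ((M : Model) → Transitive M → IsInterpretation M ⟺ (∀ p → ValidSeq M (Single (var p)) ((⊥f ⇒ ⊥f) ⇒ var p)))
lemma9 em =
  InDP-⟺validDeadEnd em ,
  symmetric⇒IsInterpretation⟺validDoubleNegation em ,
  transitive⇒IsInterpretation⟺validTop
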